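{- Let $\mathcal{C}=\langle E,X\rangle$ be a stable configuration structure. For every finite $x\in X$, $\lfloor x\rfloor_{\mathcal{C}}\odot\mathsf{E}(\mathcal{C})$ is a prime event structure.
   Context: A configuration structure over a countable set $E$ is $\langle E,X\rangle$ with $X\subseteq\mathcal{P}(E)$. $\mathcal{C}$ is stable if: $\emptyset\in X$; every nonempty $x\in X$ has $a\in x$ with $x\setminus\{a\}\in X$; $x\cup y\subseteq z$ with $x,y,z\in X$ implies $x\cup y\in X$; $X$ is closed under binary intersection; and for $x,y,z\in X$, if each of $x\cup y,y\cup z,x\cup z$ is contained in some element of $X$ then $x\cup y\cup z\in X$. $u,v\in X$ are compatible if $\{u,v\}$ has a least upper bound in $(X,\subseteq)$; a nonempty subset is pairwise consistent if every pair of distinct elements is compatible; $p\in X$ is a complete prime if for every pairwise consistent $Y\subseteq X$ whose least upper bound $\bigsqcup Y$ exists with $p\subseteq\bigsqcup Y$, some $y\in Y$ has $p\subseteq y$; $\mathsf{Pr}(\mathcal{C})$ is the set of complete primes and $\lfloor x\rfloor_{\mathcal{C}}:=\{p\in\mathsf{Pr}(\mathcal{C})\mid p\subseteq x\}$. A prime event structure is $(E,<,\#)$ with $<$ a partial order (reflexive, antisymmetric, transitive) and $\#$ irreflexive symmetric with $e\# e'<e''\Rightarrow e\# e''$; its configurations are the conflict-free, $<$-downward-closed subsets. $\mathsf{E}(\mathcal{C}):=(\mathsf{Pr}(\mathcal{C}),<,\#)$ with $p<q$ iff $p\subseteq q$ and $p\# q$ iff $p,q$ not compatible. Switch: for a prime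 event structure $\mathbb{E}=(E,<,\#)$ and a finite configuration $Y$, $Y\odot\mathbb{E}:=(E,<',\#')$ where $a<'b$ iff ($a<b$ and $\{a,b\}\cap Y=\emptyset$) or ($b<a$ and $\{a,b\}\subseteq Y$) or ($a\# b$ and $a\in Y$); and $a\#'b$ iff ($a\# b$ and $\{a,b\}\cap Y=\emptyset$) or ($a<b$, $a\in Y$, $b\notin Y$). -}

module Defs where

open import Level using (0ℓ) renaming (suc to lsuc)
open import Data.Nat using (ℕ)
open import Data.List using (List)
open import Data.List.Membership.Propositional using (_∈_)
open import Data.Product using (Σ; ∃; _×_; _,_; proj₁; proj₂)
open import Data.Sum using (_⊎_)
open import Data.Empty using (⊥)
open import Relation.Nullary using (¬_)
open import Relation.Binary.PropositionalEquality using (_≡_; _≢_)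
open import Relation.Binary.Core using (Rel)
open import Relation.Binary.Structures using (IsPartialOrder)
open import Relation.Binary.Definitions using (Irreflexive; Symmetric; _Respects₂_)
open import Function.Definitions using (Injective)

Subset : Set → Set₁
Subset E = E → Set

module _ {E : Set} where

  _⊆_ : Subset E → Subset E → Set
  x ⊆ y = ∀ {e} → x e → y e

  _≐_ : Subset E → Subset E → Set
  x ≐ y = (x ⊆ y) × (y ⊆ x)

  ∅ : Subset E
  ∅ _ = ⊥

  _∪_ : Subset E → Subset E → Subset E
  (x ∪ y) e = x e ⊎ y e

  _∩_ : Subset E → Subset E → Subset E
  (x ∩ y) e = x e × y e

  _∖[_] : Subset E → E → Subset E
  (x ∖[ a ]) e = x e × e ≢ a

  Finite : Subset E → Set
  Finite x = Σ (List E) λ l → ∀ e → (x e → e ∈ l) × (e ∈ l → x e)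

Countable : Set → Set
Countable E = Σ (E → ℕ) λ f → Injective _≡_ _≡_ f

-- Configuration structures  ⟨E , X⟩ with X ⊆ P(E).
-- X is a predicate on subsets; since subsets are predicates, membership
-- in X is required to respect equality of sets (X-resp).

record ConfStructure (E : Set) : Set₁ where
  field
    X      : Subset E → Set
    X-resp : ∀ {x y} → x ≐ y → X x → X y
open ConfStructure public

module _ {E : Set} (C : ConfStructure E) where

  record IsStable : Set₁ where
    field
      empty     : X C ∅
      coherent  : ∀ x → X C x → (∃ λ e → x e) →
                  Σ E λ a → x a × X C (x ∖[ a ])
      bounded-∪ : ∀ x y z → X C x → X C y → X C z → (x ∪ y) ⊆ z → X C (x ∪ y)
      closed-∩  : ∀ x y → X C x → X C y → X C (x ∩ y)
      three-∪   : ∀ x y z → X C x → X C y → X C z →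
                  (Σ (Subset E) λ w → X C w × (x ∪ y) ⊆ w) →
                  (Σ (Subset E) λ w → X C w × (y ∪ z) ⊆ w) →
                  (Σ (Subset E) λ w → X C w × (x ∪ z) ⊆ w) →
                  X C ((x ∪ y) ∪ z)

  IsLub : (Subset E → Set) → Subset E → Set₁
  IsLub Y w = X C w × (∀ y → Y y → y ⊆ w) ×
              (∀ w′ → X C w′ → (∀ y → Y y → y ⊆ w′) → w ⊆ w′)

  Compatible : Subset E → Subset E → Set₁
  Compatible u v = Σ (Subset E) λ w →
    IsLub (λ y → (y ≐ u) ⊎ (y ≐ v)) w

  PairwiseConsistent : (Subset E → Set) → Set₁
  PairwiseConsistent Y =
    (∃ λ y → Y y) ×
    (∀ y y′ → Y y → Y y′ → ¬ (y ≐ y′) → Compatible y y′)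

  IsCompletePrime : Subset E → Set₁
  IsCompletePrime p = X C p ×
    (∀ (Y : Subset E → Set) → (∀ y → Y y → X C y) → PairwiseConsistent Y →
     ∀ w → IsLub Y w → p ⊆ w → Σ (Subset E) λ y → Y y × p ⊆ y)

  Prime : Set₁
  Prime = Σ (Subset E) IsCompletePrime

  _≈ᴾ_ : Prime → Prime → Set
  p ≈ᴾ q = proj₁ p ≐ proj₁ q

  _<ᴾ_ : Prime → Prime → Set
  p <ᴾ q = proj₁ p ⊆ proj₁ q

  _#ᴾ_ : Prime → Prime → Set₁
  p #ᴾ q = ¬ Compatible (proj₁ p) (proj₁ q)

  ⌊_⌋ : Subset E → Prime → Set
  ⌊ x ⌋ p = proj₁ p ⊆ x

-- Prime event structures, over a carrier with an equality _≈_
-- (the events of E(C) are sets, so equality is set equality).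

record IsPrimeEventStructure {a ℓ₁ ℓ₂ ℓ₃} {A : Set a}
    (_≈_ : Rel A ℓ₁) (_<_ : Rel A ℓ₂) (_#_ : Rel A ℓ₃)
    : Set (Level._⊔_ a (Level._⊔_ ℓ₁ (Level._⊔_ ℓ₂ ℓ₃))) where
  field
    isPartialOrder : IsPartialOrder _≈_ _<_
    #-irrefl       : Irreflexive _≈_ _#_
    #-sym          : Symmetric _#_
    #-resp-≈       : _#_ Respects₂ _≈_
    #-hered        : ∀ {e e′ e″} → e # e′ → e′ < e″ → e # e″

module _ {a ℓ₂ ℓ₃ ℓ₄} {A : Set a} (Y : A → Set ℓ₄)
         (_<_ : Rel A ℓ₂) (_#_ : Rel A ℓ₃) where

  switch< : Rel A _
  switch< p q =
      (p < q × ¬ Y p × ¬ Y q)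
    ⊎ (q < p × Y p × Y q)
    ⊎ (p # q × Y p)

  switch# : Rel A _
  switch# p q =
      (p # q × ¬ Y p × ¬ Y q)
    ⊎ (p < q × Y p × ¬ Y q)
    ⊎ (q < p × Y q × ¬ Y p)

{-# OPTIONS --safe #-}
module Submission where

-- Each axiom of a prime event structure
-- for Y ⊙ 𝔼 then reduces, case by case, to the same axiom of 𝔼, provided Y respects equality and
-- is conflict-free. The only delicate case is heredity of a
-- conflict created from q < p (q ∈ Y, p ∉ Y) along an order q <′ r created from q # r: r ∈ Y would
-- put a conflict inside Y, and otherwise p # r by heredity in 𝔼. For 𝖤(𝒞) and Y = ⌊x⌋ everything
-- rests on one consequence of the bounded-union axiom: configurations with a common upper bound
-- in X are compatible.

open import Defs
open import Level using (_⊔_; 0ℓ; lift; lower) renaming (suc to lsuc)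
open import Axiom.ExcludedMiddle using (ExcludedMiddle)
open import Data.Product using (Σ; _×_; _,_; proj₁; proj₂)
open import Data.Sum using (_⊎_; inj₁; inj₂)
open import Function using (_∘_; id)
open import Relation.Nullary using (¬_; yes; no; contradiction)
open import Relation.Nullary.Decidable using (map′)
open import Relation.Unary using (Pred; Decidable)
open import Relation.Unary.Properties using (≐-refl; ≐-sym; ≐-trans; ⊆-trans)
open import Relation.Binary.Core using (Rel; _⇒_)
open import Relation.Binary.Definitions using (_Respects_; _Respects₂_; Symmetric)
open import Relation.Binary.Structures using (IsPartialOrder; IsEquivalence)

module _ {a ℓ₁ ℓ₂ ℓ₃} {A : Set a} {_≈_ : Rel A ℓ₁} {_<_ : Rel A ℓ₂} {_#_ : Rel A ℓ₃} where

  sym∧hered⇒resp-≈ : Symmetric _#_ → _≈_ ⇒ _<_ → (∀ {p q r} → p # q → q < r → p # r) →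
                     _#_ Respects₂ _≈_
  sym∧hered⇒resp-≈ #-sym ≈⇒< #-hered =
    (λ q≈q′ p#q → #-hered p#q (≈⇒< q≈q′)) ,
    (λ p≈p′ p#q → #-sym (#-hered (#-sym p#q) (≈⇒< p≈p′)))

pattern kept<    p<q p∉Y q∉Y = inj₁ (p<q , p∉Y , q∉Y)
pattern flipped< q<p p∈Y q∈Y = inj₂ (inj₁ (q<p , p∈Y , q∈Y))
pattern #⇒<      p#q p∈Y     = inj₂ (inj₂ (p#q , p∈Y))

pattern kept#    p#q p∉Y q∉Y = inj₁ (p#q , p∉Y , q∉Y)
pattern <⇒#      p<q p∈Y q∉Y = inj₂ (inj₁ (p<q , p∈Y , q∉Y))
pattern >⇒#      q<p q∈Y p∉Y = inj₂ (inj₂ (q<p , q∈Y , p∉Y))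

module SwitchProperties
  {a ℓ₁ ℓ₂ ℓ₃ ℓ} {A : Set a} {_≈_ : Rel A ℓ₁} {_<_ : Rel A ℓ₂} {_#_ : Rel A ℓ₃}
  (pes : IsPrimeEventStructure _≈_ _<_ _#_)
  {Y : Pred A ℓ} (Y? : Decidable Y) (Y-resp : Y Respects _≈_)
  (Y-conflictFree : ∀ {p q} → Y p → Y q → ¬ p # q)
  where

  open IsPrimeEventStructure pes
  open IsPartialOrder isPartialOrder
    using (isEquivalence; reflexive; antisym) renaming (trans to <-trans)
  open IsEquivalence isEquivalence using (sym)

  _<′_ : Rel A (ℓ₂ ⊔ ℓ₃ ⊔ ℓ)
  _<′_ = switch< Y _<_ _#_

  _#′_ : Rel A (ℓ₂ ⊔ ℓ₃ ⊔ ℓ)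
  _#′_ = switch# Y _<_ _#_

  #-heredˡ : ∀ {p q r} → q < p → q # r → p # r
  #-heredˡ q<p q#r = #-sym (#-hered (#-sym q#r) q<p)

  <′-reflexive : ∀ {p q} → p ≈ q → p <′ q
  <′-reflexive {p} p≈q with Y? p
  ... | yes p∈Y = flipped< (reflexive (sym p≈q)) p∈Y (Y-resp p≈q p∈Y)
  ... | no  p∉Y = kept< (reflexive p≈q) p∉Y (p∉Y ∘ Y-resp (sym p≈q))

  <′-trans : ∀ {p q r} → p <′ q → q <′ r → p <′ r
  <′-trans (kept< p<q p∉Y _)     (kept< q<r _ r∉Y)     = kept< (<-trans p<q q<r) p∉Y r∉Y
  <′-trans (kept< _ _ q∉Y)       (flipped< _ q∈Y _)    = contradiction q∈Y q∉Y
  <′-trans (kept< _ _ q∉Y)       (#⇒< _ q∈Y)           = contradiction q∈Y q∉Y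
  <′-trans (flipped< _ _ q∈Y)    (kept< _ q∉Y _)       = contradiction q∈Y q∉Y
  <′-trans (flipped< q<p p∈Y _)  (flipped< r<q _ r∈Y)  = flipped< (<-trans r<q q<p) p∈Y r∈Y
  <′-trans (flipped< q<p p∈Y _)  (#⇒< q#r _)           = #⇒< (#-heredˡ q<p q#r) p∈Y
  <′-trans (#⇒< p#q p∈Y)         (kept< q<r _ _)       = #⇒< (#-hered p#q q<r) p∈Y
  <′-trans (#⇒< p#q p∈Y)         (flipped< _ q∈Y _)    = contradiction p#q (Y-conflictFree p∈Y q∈Y)
  <′-trans (#⇒< p#q p∈Y)         (#⇒< _ q∈Y)           = contradiction p#q (Y-conflictFree p∈Y q∈Y)

  <′-antisym : ∀ {p q} → p <′ q → q <′ p → p ≈ q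
  <′-antisym (kept< p<q _ _)       (kept< q<p _ _)       = antisym p<q q<p
  <′-antisym (kept< _ p∉Y _)       (flipped< _ _ p∈Y)    = contradiction p∈Y p∉Y
  <′-antisym (kept< _ _ q∉Y)       (#⇒< _ q∈Y)           = contradiction q∈Y q∉Y
  <′-antisym (flipped< q<p _ _)    (flipped< p<q _ _)    = antisym p<q q<p
  <′-antisym (flipped< _ _ q∈Y)    (kept< _ q∉Y _)       = contradiction q∈Y q∉Y
  <′-antisym (flipped< _ p∈Y q∈Y)  (#⇒< q#p _)           = contradiction q#p (Y-conflictFree q∈Y p∈Y)
  <′-antisym (#⇒< _ p∈Y)           (kept< _ _ p∉Y)       = contradiction p∈Y p∉Y
  <′-antisym (#⇒< p#q p∈Y)         (flipped< _ q∈Y _)    = contradiction p#q (Y-conflictFree p∈Y q∈Y)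
  <′-antisym (#⇒< p#q p∈Y)         (#⇒< _ q∈Y)           = contradiction p#q (Y-conflictFree p∈Y q∈Y)

  #′-irrefl : ∀ {p q} → p ≈ q → ¬ p #′ q
  #′-irrefl p≈q (kept# p#q _ _)   = #-irrefl p≈q p#q
  #′-irrefl p≈q (<⇒# _ p∈Y q∉Y)   = q∉Y (Y-resp p≈q p∈Y)
  #′-irrefl p≈q (>⇒# _ q∈Y p∉Y)   = p∉Y (Y-resp (sym p≈q) q∈Y)

  #′-sym : ∀ {p q} → p #′ q → q #′ p
  #′-sym (kept# p#q p∉Y q∉Y) = kept# (#-sym p#q) q∉Y p∉Y
  #′-sym (<⇒# p<q p∈Y q∉Y)   = >⇒# p<q p∈Y q∉Y
  #′-sym (>⇒# q<p q∈Y p∉Y)   = <⇒# q<p q∈Y p∉Y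

  #′-hered : ∀ {p q r} → p #′ q → q <′ r → p #′ r
  #′-hered (kept# p#q p∉Y _)     (kept< q<r _ r∉Y)    = kept# (#-hered p#q q<r) p∉Y r∉Y
  #′-hered (kept# _ _ q∉Y)       (flipped< _ q∈Y _)   = contradiction q∈Y q∉Y
  #′-hered (kept# _ _ q∉Y)       (#⇒< _ q∈Y)          = contradiction q∈Y q∉Y
  #′-hered (<⇒# p<q p∈Y _)       (kept< q<r _ r∉Y)    = <⇒# (<-trans p<q q<r) p∈Y r∉Y
  #′-hered (<⇒# _ _ q∉Y)         (flipped< _ q∈Y _)   = contradiction q∈Y q∉Y
  #′-hered (<⇒# _ _ q∉Y)         (#⇒< _ q∈Y)          = contradiction q∈Y q∉Y
  #′-hered (>⇒# _ q∈Y _)         (kept< _ q∉Y _)      = contradiction q∈Y q∉Y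
  #′-hered (>⇒# q<p _ p∉Y)       (flipped< r<q _ r∈Y) = >⇒# (<-trans r<q q<p) r∈Y p∉Y
  #′-hered {r = r} (>⇒# q<p q∈Y p∉Y) (#⇒< q#r _) with Y? r
  ... | yes r∈Y = contradiction q#r (Y-conflictFree q∈Y r∈Y)
  ... | no  r∉Y = kept# (#-heredˡ q<p q#r) p∉Y r∉Y

  isPrimeEventStructure : IsPrimeEventStructure _≈_ _<′_ _#′_
  isPrimeEventStructure = record
    { isPartialOrder = record
      { isPreorder = record
        { isEquivalence = isEquivalence
        ; reflexive     = <′-reflexive
        ; trans         = <′-trans
        }
      ; antisym = <′-antisym
      }
    ; #-irrefl = #′-irrefl
    ; #-sym    = #′-sym
    ; #-resp-≈ = sym∧hered⇒resp-≈ #′-sym <′-reflexive #′-hered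
    ; #-hered  = #′-hered
    }

module PrimesOf {E : Set} (C : ConfStructure E) (stable : IsStable C) where
  open IsStable stable using (bounded-∪)

  UpperBound : Subset E → Subset E → Subset E → Set
  UpperBound u v z = X C z × u ⊆ z × v ⊆ z

  compatible⇒upperBound : ∀ {u v} → Compatible C u v → Σ (Subset E) (UpperBound u v)
  compatible⇒upperBound {u} {v} (w , w∈X , w-ub , _) =
    w , w∈X , w-ub u (inj₁ ≐-refl) , w-ub v (inj₂ ≐-refl)

  upperBound⇒compatible : ∀ {u v z} → X C u → X C v → UpperBound u v z → Compatible C u v
  upperBound⇒compatible {u} {v} {z} u∈X v∈X (z∈X , u⊆z , v⊆z) =
    u ∪ v , bounded-∪ u v z u∈X v∈X z∈X u∪v⊆z , upper , least
    where
    u∪v⊆z : (u ∪ v) ⊆ z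
    u∪v⊆z (inj₁ e∈u) = u⊆z e∈u
    u∪v⊆z (inj₂ e∈v) = v⊆z e∈v

    upper : ∀ y → (y ≐ u) ⊎ (y ≐ v) → y ⊆ (u ∪ v)
    upper y (inj₁ y≐u) = inj₁ ∘ proj₁ y≐u
    upper y (inj₂ y≐v) = inj₂ ∘ proj₁ y≐v

    least : ∀ w → X C w → (∀ y → (y ≐ u) ⊎ (y ≐ v) → y ⊆ w) → (u ∪ v) ⊆ w
    least w _ w-ub (inj₁ e∈u) = w-ub u (inj₁ ≐-refl) e∈u
    least w _ w-ub (inj₂ e∈v) = w-ub v (inj₂ ≐-refl) e∈v

  prime∈X : (p : Prime C) → X C (proj₁ p)
  prime∈X (_ , p∈X , _) = p∈X

  #ᴾ-sym : ∀ {p q} → _#ᴾ_ C p q → _#ᴾ_ C q p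
  #ᴾ-sym {p} {q} p#q q~p with compatible⇒upperBound q~p
  ... | z , z∈X , q⊆z , p⊆z = p#q (upperBound⇒compatible (prime∈X p) (prime∈X q) (z∈X , p⊆z , q⊆z))

  #ᴾ-hered : ∀ {p q r} → _#ᴾ_ C p q → _<ᴾ_ C q r → _#ᴾ_ C p r
  #ᴾ-hered {p} {q} p#q q⊆r p~r with compatible⇒upperBound p~r
  ... | z , z∈X , p⊆z , r⊆z =
    p#q (upperBound⇒compatible (prime∈X p) (prime∈X q) (z∈X , p⊆z , r⊆z ∘ q⊆r))

  #ᴾ-irrefl : ∀ {p q} → _≈ᴾ_ C p q → ¬ _#ᴾ_ C p q
  #ᴾ-irrefl {p} {q} (p⊆q , _) p#q =
    p#q (upperBound⇒compatible (prime∈X p) (prime∈X q) (prime∈X q , p⊆q , id))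

  -- The relations of 𝖤(𝒞) unfold to statements about proj₁, which does not determine the prime,
  -- so implicit prime arguments are passed by hand.
  primes-isPrimeEventStructure : IsPrimeEventStructure (_≈ᴾ_ C) (_<ᴾ_ C) (_#ᴾ_ C)
  primes-isPrimeEventStructure = record
    { isPartialOrder = record
      { isPreorder = record
        { isEquivalence = record { refl = ≐-refl ; sym = ≐-sym ; trans = ≐-trans }
        ; reflexive     = proj₁
        ; trans         = ⊆-trans
        }
      ; antisym = _,_
      }
    ; #-irrefl = λ {p} {q} → #ᴾ-irrefl {p} {q}
    ; #-sym    = λ {p} {q} → #ᴾ-sym {p} {q}
    ; #-resp-≈ = sym∧hered⇒resp-≈ (λ {p} {q} → #ᴾ-sym {p} {q}) proj₁
                                   (λ {p} {q} {r} → #ᴾ-hered {p} {q} {r})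
    ; #-hered  = λ {p} {q} {r} → #ᴾ-hered {p} {q} {r}
    }

  ⌊⌋-resp : (x : Subset E) → ⌊_⌋ C x Respects _≈ᴾ_ C
  ⌊⌋-resp x (_ , q⊆p) p⊆x = p⊆x ∘ q⊆p

  ⌊⌋-conflictFree : ∀ {x} → X C x → ∀ {p q} → ⌊_⌋ C x p → ⌊_⌋ C x q → ¬ _#ᴾ_ C p q
  ⌊⌋-conflictFree x∈X {p} {q} p⊆x q⊆x p#q =
    p#q (upperBound⇒compatible (prime∈X p) (prime∈X q) (x∈X , p⊆x , q⊆x))

mainTheorem12 : ExcludedMiddle (lsuc 0ℓ) →
    {E : Set} → Countable E → (C : ConfStructure E) → IsStable C →
    (x : Subset E) → X C x → Finite x →
    IsPrimeEventStructure (_≈ᴾ_ C)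
      (switch< (⌊_⌋ C x) (_<ᴾ_ C) (_#ᴾ_ C))
      (switch# (⌊_⌋ C x) (_<ᴾ_ C) (_#ᴾ_ C))
mainTheorem12 em _ C stable x x∈X _ =
  SwitchProperties.isPrimeEventStructure
    primes-isPrimeEventStructure ⌊x⌋?
    (λ {p} {q} → ⌊⌋-resp x {p} {q}) (λ {p} {q} → ⌊⌋-conflictFree x∈X {p} {q})
  where
  open PrimesOf C stable

  ⌊x⌋? : Decidable (⌊_⌋ C x)
  ⌊x⌋? _ = map′ lower lift em
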